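{- Let $S$ be a numerical semigroup with multiplicity $m(S) = 3$, and write its Apéry set with respect to $3$ as $\operatorname{Ap}(S)=\{0,a_1,a_2\}$, in which $a_i \equiv i \pmod{3}$ for $i=1,2$. (a) If $|a_1-a_2|\leq 2$, then $\operatorname{dim_{mat}} S=2$. (b) If $|a_1-a_2| > 2$, then $\operatorname{dim_{mat}} S=3$.
   Context: $\mathbb{N} = \{0,1,2,\ldots\}$. A numerical semigroup is an additive subsemigroup of $\mathbb{N}$ containing $0$ whose complement in $\mathbb{N}$ is finite; its multiplicity is $m(S) = \min(S\setminus\{0\})$. The Apéry set of $S$ with respect to $m = m(S)$ is $\operatorname{Ap}(S) = \{ s \in S : s - m \notin S\}$, which consists of the smallest element of $S$ in each residue class modulo $m$. For $A \in \mathsf{M}_d(\mathbb{Q})$ (the $d\times d$ rational matrices), $\mathcal{S}(A) = \{ n \in \mathbb{N} : A^n \text{ has all entries in } \mathbb{Z}\}$. The matricial dimension $\operatorname{dim_{mat}} S$ is the smallest $d$ such that $S = \mathcal{S}(A)$ for some $A \in \mathsf{M}_d(\mathbb{Q})$. -}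

module Defs where

open import Level using (0ℓ)
open import Data.Nat using (ℕ; zero; suc; _+_; _≤_; _<_; _%_)
open import Data.Fin using (Fin; zero; suc)
open import Data.Rational as ℚ using (ℚ; 0ℚ; 1ℚ)
open import Data.Product using (Σ; ∃; _×_)
open import Relation.Unary using (Pred)
open import Relation.Nullary using (¬_)
open import Relation.Binary.PropositionalEquality using (_≡_)
open import Function.Bundles using (_⇔_)

SubsetN : Set₁
SubsetN = Pred ℕ 0ℓ

record IsNumericalSemigroup (S : SubsetN) : Set where
  field
    zero∈ : S 0
    +-closed : ∀ {x y} → S x → S y → S (x + y)
    cofinite : ∃ λ N → ∀ n → N ≤ n → S n

HasMultiplicity : SubsetN → ℕ → Set
HasMultiplicity S m = (0 < m) × S m × (∀ k → 0 < k → k < m → ¬ S k)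

-- s ∈ Ap(S, m) : s ∈ S and s - m ∉ S (s - m taken in ℤ, so automatic when s < m).
InApery : SubsetN → ℕ → ℕ → Set
InApery S m s = S s × (∀ t → t + m ≡ s → ¬ S t)

Mat : ℕ → Set
Mat d = Fin d → Fin d → ℚ

sumFin : ∀ {n} → (Fin n → ℚ) → ℚ
sumFin {zero} f = 0ℚ
sumFin {suc n} f = f zero ℚ.+ sumFin (λ i → f (suc i))

_⊗_ : ∀ {d} → Mat d → Mat d → Mat d
(A ⊗ B) i j = sumFin (λ k → A i k ℚ.* B k j)

identity : ∀ {d} → Mat d
identity zero zero = 1ℚ
identity zero (suc j) = 0ℚ
identity (suc i) zero = 0ℚ
identity (suc i) (suc j) = identity i j

_^ᴹ_ : ∀ {d} → Mat d → ℕ → Mat d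
A ^ᴹ zero = identity
A ^ᴹ suc n = A ⊗ (A ^ᴹ n)

IsIntegerℚ : ℚ → Set
IsIntegerℚ q = ℚ.denominatorℕ q ≡ 1

IntegralMat : ∀ {d} → Mat d → Set
IntegralMat A = ∀ i j → IsIntegerℚ (A i j)

𝒮 : ∀ {d} → Mat d → SubsetN
𝒮 A n = IntegralMat (A ^ᴹ n)

RealizableIn : SubsetN → ℕ → Set
RealizableIn S d = ∃ λ (A : Mat d) → ∀ n → S n ⇔ 𝒮 A n

MatDimIs : SubsetN → ℕ → Set
MatDimIs S d = RealizableIn S d × (∀ d' → d' < d → ¬ RealizableIn S d')

{-# OPTIONS --safe #-}
module Submission where

-- The Apéry set gives n ∈ S ⇔ a_(n mod 3) ≤ n, where a₀ = 0.
--
-- Realizations: if D = diag (2 ^ w i), the (i, j) entry of (2 D B D⁻¹) ^ n is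
-- (B ^ n) i j · 2 ^ (n + w i − w j), so when the entries of B ^ n lie in {0, ±1} it is
-- integral iff (B ^ n) i j = 0 or w j ≤ n + w i. With B the companion matrix of
-- x² + x + 1 and w = (0, k) this realizes 3ℕ ∪ [k, ∞), which is S for k = min a₁ a₂
-- when |a₁ − a₂| ≤ 2; with B a cyclic permutation matrix and suitable weights it
-- realizes S itself in dimension 3.
--
-- Lower bounds: a rational root of a monic integer polynomial is an integer. Hence a
-- 1 × 1 matrix q with q³ ∈ ℤ has q ∈ ℤ, which would put 1 in S. For A ∈ M₂(ℚ) with A³
-- integral, det A³ = (det A)³ and tr A³ = (tr A)³ − 3 det A tr A force det A, tr A ∈ ℤ,
-- and then Cayley–Hamilton, A ^ (n + 2) = tr A · A ^ (n + 1) − det A · A ^ n, shows that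
-- n, n + 1 ∈ 𝒮 A imply n + 2 ∈ 𝒮 A. For S = 𝒮 A, using this at a₁ − 1 and at a₂ gives
-- a₂ ≤ a₁ + 1 and a₁ ≤ a₂ + 2.

open import Defs
open import Data.Nat as ℕ using (ℕ; zero; suc; _≤_; _>_; _%_; ∣_-_∣)
import Data.Nat.Properties as ℕ
import Data.Nat.Coprimality as Coprimality
import Data.Nat.DivMod as DivMod
open import Data.Nat.Divisibility as Div using (divides)
open import Data.Integer as ℤ using (ℤ; +_)
import Data.Integer.Properties as ℤ
import Data.Integer.Tactic.RingSolver as ℤ-Solver
open import Data.Rational as ℚ using (ℚ; mkℚ; 0ℚ; 1ℚ; ½; _+_; _*_; -_; _-_; ↥_; ↧_; ↧ₙ_)
import Data.Rational.Properties as ℚ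
open import Data.Rational.Unnormalised as ℚᵘ using (*≡*)
import Data.Rational.Unnormalised.Properties as ℚᵘ
open import Data.Fin using (Fin; zero; suc; _≟_; toℕ)
import Data.Fin.Properties as Fin
open import Data.Fin.Patterns using (0F; 1F; 2F)
open import Data.Product using (_×_; _,_; ∃; proj₁)
open import Data.Sum as Sum using (_⊎_; inj₁; inj₂)
open import Function using (_∘_)
open import Function.Bundles using (_⇔_; mk⇔; Equivalence)
import Function.Properties.Equivalence as ⇔
import Function.Endo.Propositional as Endo
open import Algebra.Bundles using (CommutativeRing)
open import Algebra.Properties.CommutativeSemiring.Exp
  (CommutativeRing.commutativeSemiring ℚ.+-*-commutativeRing) using (_^_; ^-homo-*)
open import Relation.Nullary using (¬_; yes; no; contradiction)
open import Relation.Nullary.Decidable using (dec⇒maybe)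
open import Relation.Binary.PropositionalEquality
open import Tactic.RingSolver using (solve-∀)
open import Tactic.RingSolver.Core.AlmostCommutativeRing using (AlmostCommutativeRing; fromCommutativeRing)

ℚ-ring : AlmostCommutativeRing _ _
ℚ-ring = fromCommutativeRing ℚ.+-*-commutativeRing (λ x → dec⇒maybe (0ℚ ℚ.≟ x))

-- Integral rationals

private
  denominator-≡1 : ∀ {p q r} {x : ℤ} → ↧ r ℤ.* x ≡ ↧ p ℤ.* ↧ q →
                   IsIntegerℚ p → IsIntegerℚ q → IsIntegerℚ r
  denominator-≡1 {p} {q} {r} {x} eq p∈ℤ q∈ℤ = ℕ.m*n≡1⇒m≡1 (↧ₙ r) ℤ.∣ x ∣ (begin
    ↧ₙ r ℕ.* ℤ.∣ x ∣      ≡⟨ ℤ.abs-* (↧ r) x ⟨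
    ℤ.∣ ↧ r ℤ.* x ∣       ≡⟨ cong ℤ.∣_∣ eq ⟩
    ℤ.∣ ↧ p ℤ.* ↧ q ∣     ≡⟨ ℤ.abs-* (↧ p) (↧ q) ⟩
    ↧ₙ p ℕ.* ↧ₙ q         ≡⟨ cong₂ ℕ._*_ p∈ℤ q∈ℤ ⟩
    1                     ∎)
    where open ≡-Reasoning

isInteger-+ : ∀ {p q} → IsIntegerℚ p → IsIntegerℚ q → IsIntegerℚ (p + q)
isInteger-+ {p} {q} = denominator-≡1 {p} {q} {p + q} (ℚ.↧-+ p q)

isInteger-* : ∀ {p q} → IsIntegerℚ p → IsIntegerℚ q → IsIntegerℚ (p * q)
isInteger-* {p} {q} = denominator-≡1 {p} {q} {p * q} (ℚ.↧-* p q)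

isInteger-neg : ∀ {p} → IsIntegerℚ p → IsIntegerℚ (- p)
isInteger-neg {p} = trans (cong ℤ.∣_∣ (ℚ.↧-neg p))

isInteger-- : ∀ {p q} → IsIntegerℚ p → IsIntegerℚ q → IsIntegerℚ (p - q)
isInteger-- {p} {q} p∈ℤ q∈ℤ = isInteger-+ {p} { - q} p∈ℤ (isInteger-neg {q} q∈ℤ)

private
  toℚᵘ-cubic : ∀ q r → ℚ.toℚᵘ (q * q * q + r * q) ℚᵘ.≃
               ℚ.toℚᵘ q ℚᵘ.* ℚ.toℚᵘ q ℚᵘ.* ℚ.toℚᵘ q ℚᵘ.+ ℚ.toℚᵘ r ℚᵘ.* ℚ.toℚᵘ q
  toℚᵘ-cubic q r = begin
    ℚ.toℚᵘ (q * q * q + r * q)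
      ≈⟨ ℚ.toℚᵘ-homo-+ (q * q * q) (r * q) ⟩
    ℚ.toℚᵘ (q * q * q) ℚᵘ.+ ℚ.toℚᵘ (r * q)
      ≈⟨ ℚᵘ.+-cong (ℚᵘ.≃-trans (ℚ.toℚᵘ-homo-* (q * q) q) (ℚᵘ.*-congʳ (ℚ.toℚᵘ-homo-* q q)))
                 (ℚ.toℚᵘ-homo-* r q) ⟩
    ℚ.toℚᵘ q ℚᵘ.* ℚ.toℚᵘ q ℚᵘ.* ℚ.toℚᵘ q ℚᵘ.+ ℚ.toℚᵘ r ℚᵘ.* ℚ.toℚᵘ q
      ∎
    where open ℚᵘ.≃-Reasoning

  numerator³-multiple : ∀ {q r c} → q * q * q + r * q ≡ c → IsIntegerℚ r → IsIntegerℚ c →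
                        ∃ λ k → ↥ q ℤ.* ↥ q ℤ.* ↥ q ≡ ↧ q ℤ.* k
  numerator³-multiple {q@(mkℚ n s-1 _)} {r@(mkℚ ρ zero _)} {mkℚ γ zero _} eq refl refl =
    γ ℤ.* s ℤ.* s ℤ.- ρ ℤ.* n ℤ.* s , ℤ.*-cancelˡ-≡ s _ _ (begin
      s ℤ.* (n ℤ.* n ℤ.* n)                            ≡⟨ isolate s n ρ ⟩
      lhs ℤ.- ρns³                                     ≡⟨ cong (ℤ._- ρns³) cleared ⟩
      rhs ℤ.- ρns³                                     ≡⟨ factor s n ρ γ ⟩
      s ℤ.* (s ℤ.* (γ ℤ.* s ℤ.* s ℤ.- ρ ℤ.* n ℤ.* s))  ∎)
    where
    open ≡-Reasoning
    s = + suc s-1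
    ρns³ = ρ ℤ.* n ℤ.* (s ℤ.* s ℤ.* s)
    -- q³ + r q = c with denominators cleared, in the shape produced by ℚᵘ arithmetic
    lhs rhs : ℤ
    lhs = (n ℤ.* n ℤ.* n ℤ.* (+ 1 ℤ.* s) ℤ.+ ρ ℤ.* n ℤ.* (s ℤ.* s ℤ.* s)) ℤ.* + 1
    rhs = γ ℤ.* (s ℤ.* s ℤ.* s ℤ.* (+ 1 ℤ.* s))
    cleared : lhs ≡ rhs
    cleared with ℚᵘ.≃-trans (ℚᵘ.≃-sym (toℚᵘ-cubic q r)) (ℚ.toℚᵘ-cong eq)
    ... | *≡* e = e
    isolate : ∀ s n ρ →
      s ℤ.* (n ℤ.* n ℤ.* n) ≡
      (n ℤ.* n ℤ.* n ℤ.* (+ 1 ℤ.* s) ℤ.+ ρ ℤ.* n ℤ.* (s ℤ.* s ℤ.* s)) ℤ.* + 1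
        ℤ.- ρ ℤ.* n ℤ.* (s ℤ.* s ℤ.* s)
    isolate = ℤ-Solver.solve-∀
    factor : ∀ s n ρ γ →
      γ ℤ.* (s ℤ.* s ℤ.* s ℤ.* (+ 1 ℤ.* s)) ℤ.- ρ ℤ.* n ℤ.* (s ℤ.* s ℤ.* s) ≡
      s ℤ.* (s ℤ.* (γ ℤ.* s ℤ.* s ℤ.- ρ ℤ.* n ℤ.* s))
    factor = ℤ-Solver.solve-∀

isInteger-cubicRoot : ∀ {q r} → IsIntegerℚ r → IsIntegerℚ (q * q * q + r * q) → IsIntegerℚ q
isInteger-cubicRoot {q@(mkℚ n s-1 n⊥s)} {r} r∈ℤ c∈ℤ with numerator³-multiple {q} {r} refl r∈ℤ c∈ℤ
... | k , n³≡sk = Coprimality.recompute n⊥s (s∣m , Div.∣-refl)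
  where
  open ≡-Reasoning
  m = ℤ.∣ n ∣
  s⊥m : Coprimality.Coprime (suc s-1) m
  s⊥m = Coprimality.sym (Coprimality.recompute n⊥s)
  m³≡ : m ℕ.* (m ℕ.* m) ≡ ℤ.∣ k ∣ ℕ.* suc s-1
  m³≡ = begin
    m ℕ.* (m ℕ.* m)           ≡⟨ ℕ.*-assoc m m m ⟨
    m ℕ.* m ℕ.* m             ≡⟨ cong (ℕ._* m) (ℤ.abs-* n n) ⟨
    ℤ.∣ n ℤ.* n ∣ ℕ.* m       ≡⟨ ℤ.abs-* (n ℤ.* n) n ⟨
    ℤ.∣ n ℤ.* n ℤ.* n ∣       ≡⟨ cong ℤ.∣_∣ n³≡sk ⟩
    ℤ.∣ + suc s-1 ℤ.* k ∣     ≡⟨ ℤ.abs-* (+ suc s-1) k ⟩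
    suc s-1 ℕ.* ℤ.∣ k ∣       ≡⟨ ℕ.*-comm (suc s-1) ℤ.∣ k ∣ ⟩
    ℤ.∣ k ∣ ℕ.* suc s-1       ∎
  s∣m : suc s-1 Div.∣ m
  s∣m = Coprimality.coprime-divisor s⊥m (Coprimality.coprime-divisor s⊥m (divides ℤ.∣ k ∣ m³≡))

2ℚ : ℚ
2ℚ = + 2 ℚ./ 1

isInteger-2^ : ∀ k → IsIntegerℚ (2ℚ ^ k)
isInteger-2^ zero    = refl
isInteger-2^ (suc k) = isInteger-* {2ℚ} {2ℚ ^ k} refl (isInteger-2^ k)

½^*2^ : ∀ k → ½ ^ k * 2ℚ ^ k ≡ 1ℚ
½^*2^ zero    = refl
½^*2^ (suc k) = begin
  ½ * ½ ^ k * (2ℚ * 2ℚ ^ k)     ≡⟨ interchange ½ (½ ^ k) 2ℚ (2ℚ ^ k) ⟩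
  ½ * 2ℚ * (½ ^ k * 2ℚ ^ k)     ≡⟨ cong (½ * 2ℚ *_) (½^*2^ k) ⟩
  1ℚ                            ∎
  where
  open ≡-Reasoning
  interchange : ∀ a b c d → a * b * (c * d) ≡ a * c * (b * d)
  interchange = solve-∀ ℚ-ring

2^[k+a]*½^k : ∀ k a → 2ℚ ^ (k ℕ.+ a) * ½ ^ k ≡ 2ℚ ^ a
2^[k+a]*½^k k a = begin
  2ℚ ^ (k ℕ.+ a) * ½ ^ k        ≡⟨ cong (_* ½ ^ k) (^-homo-* 2ℚ k a) ⟩
  2ℚ ^ k * 2ℚ ^ a * ½ ^ k       ≡⟨ regroup (2ℚ ^ k) (2ℚ ^ a) (½ ^ k) ⟩
  ½ ^ k * 2ℚ ^ k * 2ℚ ^ a       ≡⟨ cong (_* 2ℚ ^ a) (½^*2^ k) ⟩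
  1ℚ * 2ℚ ^ a                   ≡⟨ ℚ.*-identityˡ _ ⟩
  2ℚ ^ a                        ∎
  where
  open ≡-Reasoning
  regroup : ∀ x y z → x * y * z ≡ z * x * y
  regroup = solve-∀ ℚ-ring

2^k*½^[k+b] : ∀ k b → 2ℚ ^ k * ½ ^ (k ℕ.+ b) ≡ ½ ^ b
2^k*½^[k+b] k b = begin
  2ℚ ^ k * ½ ^ (k ℕ.+ b)        ≡⟨ cong (2ℚ ^ k *_) (^-homo-* ½ k b) ⟩
  2ℚ ^ k * (½ ^ k * ½ ^ b)      ≡⟨ regroup (2ℚ ^ k) (½ ^ k) (½ ^ b) ⟩
  ½ ^ k * 2ℚ ^ k * ½ ^ b        ≡⟨ cong (_* ½ ^ b) (½^*2^ k) ⟩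
  1ℚ * ½ ^ b                    ≡⟨ ℚ.*-identityˡ _ ⟩
  ½ ^ b                         ∎
  where
  open ≡-Reasoning
  regroup : ∀ x y z → x * (y * z) ≡ y * x * z
  regroup = solve-∀ ℚ-ring

¬isInteger-½ : ¬ IsIntegerℚ ½
¬isInteger-½ ()

¬isInteger-½^suc : ∀ k → ¬ IsIntegerℚ (½ ^ suc k)
¬isInteger-½^suc k ½^suc∈ℤ =
  ¬isInteger-½ (subst IsIntegerℚ ½^suc*2^≡½ (isInteger-* {½ ^ suc k} {2ℚ ^ k} ½^suc∈ℤ (isInteger-2^ k)))
  where
  open ≡-Reasoning
  ½^suc*2^≡½ : ½ ^ suc k * 2ℚ ^ k ≡ ½
  ½^suc*2^≡½ = begin
    ½ * ½ ^ k * 2ℚ ^ k            ≡⟨ ℚ.*-assoc ½ (½ ^ k) (2ℚ ^ k) ⟩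
    ½ * (½ ^ k * 2ℚ ^ k)          ≡⟨ cong (½ *_) (½^*2^ k) ⟩
    ½ * 1ℚ                        ≡⟨ ℚ.*-identityʳ ½ ⟩
    ½                             ∎

isInteger-2^*½^ : ∀ {a b} → b ≤ a → IsIntegerℚ (2ℚ ^ a * ½ ^ b)
isInteger-2^*½^ {b = b} b≤a with ℕ.m≤n⇒∃[o]m+o≡n b≤a
... | k , refl = subst IsIntegerℚ (sym (2^[k+a]*½^k b k)) (isInteger-2^ k)

isInteger-2^*½^⇒ : ∀ {a b} → IsIntegerℚ (2ℚ ^ a * ½ ^ b) → b ≤ a
isInteger-2^*½^⇒ {a} {b} 2^a*½^b∈ℤ with b ℕ.≤? a
... | yes b≤a = b≤a
... | no b≰a with ℕ.m≤n⇒∃[o]m+o≡n (ℕ.≰⇒> b≰a)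
...   | k , refl = contradiction (subst IsIntegerℚ (2^k*½^[k+b] a (suc k)) 2^a*½^[a+1+k]∈ℤ) (¬isInteger-½^suc k)
  where
  2^a*½^[a+1+k]∈ℤ : IsIntegerℚ (2ℚ ^ a * ½ ^ (a ℕ.+ suc k))
  2^a*½^[a+1+k]∈ℤ = subst (λ x → IsIntegerℚ (2ℚ ^ a * ½ ^ x)) (sym (ℕ.+-suc a k)) 2^a*½^b∈ℤ

-- Matrices

sumFin-cong : ∀ {d} {f g : Fin d → ℚ} → (∀ k → f k ≡ g k) → sumFin f ≡ sumFin g
sumFin-cong {zero}  f≗g = refl
sumFin-cong {suc d} f≗g = cong₂ _+_ (f≗g zero) (sumFin-cong (λ k → f≗g (suc k)))

sumFin-*ʳ : ∀ {d} (f : Fin d → ℚ) c → sumFin (λ k → f k * c) ≡ sumFin f * c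
sumFin-*ʳ {zero}  f c = sym (ℚ.*-zeroˡ c)
sumFin-*ʳ {suc d} f c = trans (cong (_+_ (f zero * c)) (sumFin-*ʳ (λ k → f (suc k)) c))
                              (sym (ℚ.*-distribʳ-+ c (f zero) _))

sumFin-0* : ∀ {d} (f : Fin d → ℚ) → sumFin (λ k → 0ℚ * f k) ≡ 0ℚ
sumFin-0* {zero}  f = refl
sumFin-0* {suc d} f = cong₂ _+_ (ℚ.*-zeroˡ (f zero)) (sumFin-0* (λ k → f (suc k)))

sumFin-identityˡ : ∀ {d} (i : Fin d) (f : Fin d → ℚ) → sumFin (λ k → identity i k * f k) ≡ f i
sumFin-identityˡ zero    f = trans (cong₂ _+_ (ℚ.*-identityˡ (f zero)) (sumFin-0* (λ k → f (suc k))))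
                                   (ℚ.+-identityʳ (f zero))
sumFin-identityˡ (suc i) f = trans (cong₂ _+_ (ℚ.*-zeroˡ (f zero)) (sumFin-identityˡ i (λ k → f (suc k))))
                                   (ℚ.+-identityˡ (f (suc i)))

identity-≡ : ∀ {d} (i : Fin d) → identity i i ≡ 1ℚ
identity-≡ zero    = refl
identity-≡ (suc i) = identity-≡ i

identity-≢ : ∀ {d} {i j : Fin d} → i ≢ j → identity i j ≡ 0ℚ
identity-≢ {i = zero}  {zero}  i≢j = contradiction refl i≢j
identity-≢ {i = zero}  {suc j} i≢j = refl
identity-≢ {i = suc i} {zero}  i≢j = refl
identity-≢ {i = suc i} {suc j} i≢j = identity-≢ (i≢j ∘ cong suc)

identity-comm : ∀ {d} (i j : Fin d) → identity i j ≡ identity j i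
identity-comm zero    zero    = refl
identity-comm zero    (suc j) = refl
identity-comm (suc i) zero    = refl
identity-comm (suc i) (suc j) = identity-comm i j

⊗-identityʳ : ∀ {d} (A : Mat d) i j → (A ⊗ identity) i j ≡ A i j
⊗-identityʳ A i j =
  trans (sumFin-cong (λ k → trans (cong (A i k *_) (identity-comm k j)) (ℚ.*-comm (A i k) _)))
        (sumFin-identityˡ j (A i))

isInteger-identity : ∀ {d} (i j : Fin d) → IsIntegerℚ (identity i j)
isInteger-identity zero    zero    = refl
isInteger-identity zero    (suc j) = refl
isInteger-identity (suc i) zero    = refl
isInteger-identity (suc i) (suc j) = isInteger-identity i j

isInteger-sumFin : ∀ {d} {f : Fin d → ℚ} → (∀ k → IsIntegerℚ (f k)) → IsIntegerℚ (sumFin f)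
isInteger-sumFin {zero}          f∈ℤ = refl
isInteger-sumFin {suc d} {f = f} f∈ℤ =
  isInteger-+ {f zero} {sumFin (λ k → f (suc k))} (f∈ℤ zero) (isInteger-sumFin (λ k → f∈ℤ (suc k)))

integral-⊗ : ∀ {d} {A B : Mat d} → IntegralMat A → IntegralMat B → IntegralMat (A ⊗ B)
integral-⊗ {A = A} {B} A∈ℤ B∈ℤ i j =
  isInteger-sumFin (λ k → isInteger-* {A i k} {B k j} (A∈ℤ i k) (B∈ℤ k j))

integral⇒𝒮 : ∀ {d} {A : Mat d} → IntegralMat A → ∀ n → 𝒮 A n
integral⇒𝒮 A∈ℤ zero            = isInteger-identity
integral⇒𝒮 {A = A} A∈ℤ (suc n) = integral-⊗ {A = A} {A ^ᴹ n} A∈ℤ (integral⇒𝒮 A∈ℤ n)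

conjugate : ∀ {d} → ℚ → (Fin d → ℚ) → (Fin d → ℚ) → Mat d → Mat d
conjugate c u v B i j = c * (u i * B i j * v j)

conjugate-^ᴹ : ∀ {d} c (u v : Fin d → ℚ) B → (∀ k → v k * u k ≡ 1ℚ) →
               ∀ n i j → (conjugate c u v B ^ᴹ n) i j ≡ c ^ n * (u i * (B ^ᴹ n) i j * v j)
conjugate-^ᴹ c u v B vu≡1 zero i j with i ≟ j
... | yes refl rewrite identity-≡ i = trans (sym (vu≡1 i)) (diagonal (u i) (v i))
  where
  diagonal : ∀ x y → y * x ≡ 1ℚ * (x * 1ℚ * y)
  diagonal = solve-∀ ℚ-ring
... | no i≢j rewrite identity-≢ i≢j = offDiagonal (u i) (v j)
  where
  offDiagonal : ∀ x y → 0ℚ ≡ 1ℚ * (x * 0ℚ * y)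
  offDiagonal = solve-∀ ℚ-ring
conjugate-^ᴹ c u v B vu≡1 (suc n) i j = begin
  sumFin (λ k → C i k * (C ^ᴹ n) k j)
    ≡⟨ sumFin-cong (λ k → cong (C i k *_) (conjugate-^ᴹ c u v B vu≡1 n k j)) ⟩
  sumFin (λ k → C i k * (c ^ n * (u k * M k j * v j)))
    ≡⟨ sumFin-cong summand ⟩
  sumFin (λ k → B i k * M k j * X)
    ≡⟨ sumFin-*ʳ (λ k → B i k * M k j) X ⟩
  (B ⊗ M) i j * X
    ≡⟨ regroup ((B ⊗ M) i j) c (c ^ n) (u i) (v j) ⟩
  c ^ suc n * (u i * (B ⊗ M) i j * v j)
    ∎
  where
  open ≡-Reasoning
  C = conjugate c u v B
  M = B ^ᴹ n
  X = c * c ^ n * u i * v j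
  cancel : ∀ b m c cₙ uᵢ vₖ uₖ vⱼ →
           c * (uᵢ * b * vₖ) * (cₙ * (uₖ * m * vⱼ)) ≡ b * m * (c * cₙ * uᵢ * vⱼ) * (vₖ * uₖ)
  cancel = solve-∀ ℚ-ring
  summand : ∀ k → C i k * (c ^ n * (u k * M k j * v j)) ≡ B i k * M k j * X
  summand k = begin
    C i k * (c ^ n * (u k * M k j * v j))   ≡⟨ cancel (B i k) (M k j) c (c ^ n) (u i) (v k) (u k) (v j) ⟩
    B i k * M k j * X * (v k * u k)         ≡⟨ cong (B i k * M k j * X *_) (vu≡1 k) ⟩
    B i k * M k j * X * 1ℚ                  ≡⟨ ℚ.*-identityʳ _ ⟩
    B i k * M k j * X                       ∎
  regroup : ∀ s c cₙ uᵢ vⱼ → s * (c * cₙ * uᵢ * vⱼ) ≡ c * cₙ * (uᵢ * s * vⱼ)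
  regroup = solve-∀ ℚ-ring

weighted : ∀ {d} → Mat d → (Fin d → ℕ) → Mat d
weighted B w = conjugate 2ℚ (λ i → 2ℚ ^ w i) (λ j → ½ ^ w j) B

weighted-^ᴹ : ∀ {d} (B : Mat d) w n i j →
              (weighted B w ^ᴹ n) i j ≡ (B ^ᴹ n) i j * (2ℚ ^ (n ℕ.+ w i) * ½ ^ w j)
weighted-^ᴹ B w n i j = begin
  (weighted B w ^ᴹ n) i j
    ≡⟨ conjugate-^ᴹ 2ℚ (λ i → 2ℚ ^ w i) (λ j → ½ ^ w j) B (λ k → ½^*2^ (w k)) n i j ⟩
  2ℚ ^ n * (2ℚ ^ w i * (B ^ᴹ n) i j * ½ ^ w j)
    ≡⟨ regroup (2ℚ ^ n) (2ℚ ^ w i) ((B ^ᴹ n) i j) (½ ^ w j) ⟩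
  (B ^ᴹ n) i j * (2ℚ ^ n * 2ℚ ^ w i * ½ ^ w j)
    ≡⟨ cong (λ x → (B ^ᴹ n) i j * (x * ½ ^ w j)) (^-homo-* 2ℚ n (w i)) ⟨
  (B ^ᴹ n) i j * (2ℚ ^ (n ℕ.+ w i) * ½ ^ w j)
    ∎
  where
  open ≡-Reasoning
  regroup : ∀ x y b z → x * (y * b * z) ≡ b * (x * y * z)
  regroup = solve-∀ ℚ-ring

weighted-𝒮 : ∀ {d} (B : Mat d) w n → 𝒮 B n → (∀ i j → (B ^ᴹ n) i j ≡ 0ℚ ⊎ w j ≤ n ℕ.+ w i) →
             𝒮 (weighted B w) n
weighted-𝒮 B w n Bⁿ∈ℤ support i j = subst IsIntegerℚ (sym (weighted-^ᴹ B w n i j)) (entry (support i j))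
  where
  X = 2ℚ ^ (n ℕ.+ w i) * ½ ^ w j
  entry : (B ^ᴹ n) i j ≡ 0ℚ ⊎ w j ≤ n ℕ.+ w i → IsIntegerℚ ((B ^ᴹ n) i j * X)
  entry (inj₁ b≡0) = subst IsIntegerℚ (sym (trans (cong (_* X) b≡0) (ℚ.*-zeroˡ X))) refl
  entry (inj₂ wⱼ≤) = isInteger-* {(B ^ᴹ n) i j} (Bⁿ∈ℤ i j) (isInteger-2^*½^ wⱼ≤)

weighted-𝒮⁻¹ : ∀ {d} (B : Mat d) w n → 𝒮 (weighted B w) n →
               ∀ i j → (B ^ᴹ n) i j ≡ 1ℚ ⊎ (B ^ᴹ n) i j ≡ - 1ℚ → w j ≤ n ℕ.+ w i
weighted-𝒮⁻¹ B w n Aⁿ∈ℤ i j unit = isInteger-2^*½^⇒ (entry unit)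
  where
  X = 2ℚ ^ (n ℕ.+ w i) * ½ ^ w j
  Aⁿᵢⱼ∈ℤ : IsIntegerℚ ((B ^ᴹ n) i j * X)
  Aⁿᵢⱼ∈ℤ = subst IsIntegerℚ (weighted-^ᴹ B w n i j) (Aⁿ∈ℤ i j)
  -[-1*x]≡x : ∀ x → - (- 1ℚ * x) ≡ x
  -[-1*x]≡x = solve-∀ ℚ-ring
  entry : (B ^ᴹ n) i j ≡ 1ℚ ⊎ (B ^ᴹ n) i j ≡ - 1ℚ → IsIntegerℚ X
  entry (inj₁ b≡1)  = subst IsIntegerℚ (trans (cong (_* X) b≡1) (ℚ.*-identityˡ X)) Aⁿᵢⱼ∈ℤ
  entry (inj₂ b≡-1) = subst IsIntegerℚ (-[-1*x]≡x X)
    (isInteger-neg { - 1ℚ * X} (subst IsIntegerℚ (cong (_* X) b≡-1) Aⁿᵢⱼ∈ℤ))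

permutation : ∀ {d} → (Fin d → Fin d) → Mat d
permutation σ i j = identity (σ i) j

module _ {d : ℕ} where
  open Endo (Fin d) public using (^-homo) renaming (_^_ to _^ᶠ_)

  ^ᶠ-comm : ∀ (σ : Fin d → Fin d) n i → (σ ^ᶠ n) (σ i) ≡ σ ((σ ^ᶠ n) i)
  ^ᶠ-comm σ n i = sym (cong-app (trans (cong (σ ^ᶠ_) (ℕ.+-comm 1 n)) (^-homo σ n 1)) i)

  permutation-^ᴹ : ∀ (σ : Fin d → Fin d) n i j → (permutation σ ^ᴹ n) i j ≡ identity ((σ ^ᶠ n) i) j
  permutation-^ᴹ σ zero    i j = refl
  permutation-^ᴹ σ (suc n) i j = begin
    sumFin (λ k → identity (σ i) k * (permutation σ ^ᴹ n) k j)
      ≡⟨ sumFin-identityˡ (σ i) (λ k → (permutation σ ^ᴹ n) k j) ⟩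
    (permutation σ ^ᴹ n) (σ i) j
      ≡⟨ permutation-^ᴹ σ n (σ i) j ⟩
    identity ((σ ^ᶠ n) (σ i)) j
      ≡⟨ cong (λ k → identity k j) (^ᶠ-comm σ n i) ⟩
    identity ((σ ^ᶠ suc n) i) j
      ∎
    where open ≡-Reasoning

  weightedPermutation-𝒮 : ∀ (σ : Fin d → Fin d) w n →
                          𝒮 (weighted (permutation σ) w) n ⇔ (∀ i → w ((σ ^ᶠ n) i) ≤ n ℕ.+ w i)
  weightedPermutation-𝒮 σ w n = mk⇔
    (λ Aⁿ∈ℤ i → weighted-𝒮⁻¹ P w n Aⁿ∈ℤ i ((σ ^ᶠ n) i)
                  (inj₁ (trans (permutation-^ᴹ σ n i _) (identity-≡ ((σ ^ᶠ n) i)))))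
    (weighted-𝒮 P w n Pⁿ∈ℤ ∘ support)
    where
    P = permutation σ
    Pⁿ∈ℤ : 𝒮 P n
    Pⁿ∈ℤ i j = subst IsIntegerℚ (sym (permutation-^ᴹ σ n i j)) (isInteger-identity ((σ ^ᶠ n) i) j)
    support : (∀ i → w ((σ ^ᶠ n) i) ≤ n ℕ.+ w i) → ∀ i j → (P ^ᴹ n) i j ≡ 0ℚ ⊎ w j ≤ n ℕ.+ w i
    support moves i j with (σ ^ᶠ n) i ≟ j
    ... | yes refl  = inj₂ (moves i)
    ... | no σⁿi≢j = inj₁ (trans (permutation-^ᴹ σ n i j) (identity-≢ σⁿi≢j))

-- 2 × 2 matrices

tr det : Mat 2 → ℚ
tr A  = A 0F 0F + A 1F 1F
det A = A 0F 0F * A 1F 1F - A 0F 1F * A 1F 0F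

cayleyHamilton : ∀ (A : Mat 2) i j → sumFin (λ k → A i k * A k j) ≡ tr A * A i j - det A * identity i j
cayleyHamilton A 0F 0F = ch (A 0F 0F) (A 0F 1F) (A 1F 0F) (A 1F 1F)
  where
  ch : ∀ a b c e → a * a + (b * c + 0ℚ) ≡ (a + e) * a - (a * e - b * c) * 1ℚ
  ch = solve-∀ ℚ-ring
cayleyHamilton A 0F 1F = ch (A 0F 0F) (A 0F 1F) (A 1F 0F) (A 1F 1F)
  where
  ch : ∀ a b c e → a * b + (b * e + 0ℚ) ≡ (a + e) * b - (a * e - b * c) * 0ℚ
  ch = solve-∀ ℚ-ring
cayleyHamilton A 1F 0F = ch (A 0F 0F) (A 0F 1F) (A 1F 0F) (A 1F 1F)
  where
  ch : ∀ a b c e → c * a + (e * c + 0ℚ) ≡ (a + e) * c - (a * e - b * c) * 0ℚ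
  ch = solve-∀ ℚ-ring
cayleyHamilton A 1F 1F = ch (A 0F 0F) (A 0F 1F) (A 1F 0F) (A 1F 1F)
  where
  ch : ∀ a b c e → c * b + (e * e + 0ℚ) ≡ (a + e) * e - (a * e - b * c) * 1ℚ
  ch = solve-∀ ℚ-ring

cayleyHamilton-^ᴹ : ∀ (A : Mat 2) n i j →
                    (A ^ᴹ (2 ℕ.+ n)) i j ≡ tr A * (A ^ᴹ (1 ℕ.+ n)) i j - det A * (A ^ᴹ n) i j
cayleyHamilton-^ᴹ A zero i j = begin
  sumFin (λ k → A i k * (A ⊗ identity) k j)
    ≡⟨ sumFin-cong (λ k → cong (A i k *_) (⊗-identityʳ A k j)) ⟩
  sumFin (λ k → A i k * A k j)
    ≡⟨ cayleyHamilton A i j ⟩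
  tr A * A i j - det A * identity i j
    ≡⟨ cong (λ x → tr A * x - det A * identity i j) (⊗-identityʳ A i j) ⟨
  tr A * (A ⊗ identity) i j - det A * identity i j
    ∎
  where open ≡-Reasoning
cayleyHamilton-^ᴹ A (suc n) i j = begin
  sumFin (λ k → A i k * (A ^ᴹ (2 ℕ.+ n)) k j)
    ≡⟨ sumFin-cong (λ k → cong (A i k *_) (cayleyHamilton-^ᴹ A n k j)) ⟩
  sumFin (λ k → A i k * (tr A * X k j - det A * Y k j))
    ≡⟨ linear (A i 0F) (A i 1F) (X 0F j) (X 1F j) (Y 0F j) (Y 1F j) (tr A) (det A) ⟩
  tr A * (A ⊗ X) i j - det A * (A ⊗ Y) i j
    ∎
  where
  open ≡-Reasoning
  X = A ^ᴹ (1 ℕ.+ n)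
  Y = A ^ᴹ n
  linear : ∀ a₀ a₁ x₀ x₁ y₀ y₁ t d →
           a₀ * (t * x₀ - d * y₀) + (a₁ * (t * x₁ - d * y₁) + 0ℚ) ≡
           t * (a₀ * x₀ + (a₁ * x₁ + 0ℚ)) - d * (a₀ * y₀ + (a₁ * y₁ + 0ℚ))
  linear = solve-∀ ℚ-ring

^ᴹ3 : ∀ (A : Mat 2) i j → (A ^ᴹ 3) i j ≡ (tr A * tr A - det A) * A i j - tr A * det A * identity i j
^ᴹ3 A i j = begin
  (A ^ᴹ 3) i j
    ≡⟨ cayleyHamilton-^ᴹ A 1 i j ⟩
  tr A * (A ^ᴹ 2) i j - det A * (A ^ᴹ 1) i j
    ≡⟨ cong₂ (λ x y → tr A * x - det A * y) A²ᵢⱼ (⊗-identityʳ A i j) ⟩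
  tr A * (tr A * A i j - det A * identity i j) - det A * A i j
    ≡⟨ expand (tr A) (det A) (A i j) (identity i j) ⟩
  (tr A * tr A - det A) * A i j - tr A * det A * identity i j
    ∎
  where
  open ≡-Reasoning
  A²ᵢⱼ : (A ^ᴹ 2) i j ≡ tr A * A i j - det A * identity i j
  A²ᵢⱼ = trans (cayleyHamilton-^ᴹ A 0 i j) (cong (λ x → tr A * x - det A * identity i j) (⊗-identityʳ A i j))
  expand : ∀ t d a δ → t * (t * a - d * δ) - d * a ≡ (t * t - d) * a - t * d * δ
  expand = solve-∀ ℚ-ring

tr-^ᴹ3 : ∀ (A : Mat 2) → tr (A ^ᴹ 3) ≡ tr A * tr A * tr A + (- (det A + det A + det A)) * tr A
tr-^ᴹ3 A = trans (cong₂ _+_ (^ᴹ3 A 0F 0F) (^ᴹ3 A 1F 1F)) (trace (A 0F 0F) (A 0F 1F) (A 1F 0F) (A 1F 1F))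
  where
  trace : ∀ a b c e → let t = a + e; d = a * e - b * c in
          ((t * t - d) * a - t * d * 1ℚ) + ((t * t - d) * e - t * d * 1ℚ) ≡ t * t * t + (- (d + d + d)) * t
  trace = solve-∀ ℚ-ring

det-^ᴹ3 : ∀ (A : Mat 2) → det (A ^ᴹ 3) ≡ det A * det A * det A + 0ℚ * det A
det-^ᴹ3 A =
  trans (cong₂ _-_ (cong₂ _*_ (^ᴹ3 A 0F 0F) (^ᴹ3 A 1F 1F)) (cong₂ _*_ (^ᴹ3 A 0F 1F) (^ᴹ3 A 1F 0F)))
        (determinant (A 0F 0F) (A 0F 1F) (A 1F 0F) (A 1F 1F))
  where
  determinant : ∀ a b c e → let t = a + e; d = a * e - b * c in
    ((t * t - d) * a - t * d * 1ℚ) * ((t * t - d) * e - t * d * 1ℚ) -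
    ((t * t - d) * b - t * d * 0ℚ) * ((t * t - d) * c - t * d * 0ℚ)
    ≡ d * d * d + 0ℚ * d
  determinant = solve-∀ ℚ-ring

isInteger-tr : ∀ {M : Mat 2} → IntegralMat M → IsIntegerℚ (tr M)
isInteger-tr {M} M∈ℤ = isInteger-+ {M 0F 0F} {M 1F 1F} (M∈ℤ 0F 0F) (M∈ℤ 1F 1F)

isInteger-det : ∀ {M : Mat 2} → IntegralMat M → IsIntegerℚ (det M)
isInteger-det {M} M∈ℤ = isInteger-- {M 0F 0F * M 1F 1F} {M 0F 1F * M 1F 0F}
  (isInteger-* {M 0F 0F} {M 1F 1F} (M∈ℤ 0F 0F) (M∈ℤ 1F 1F))
  (isInteger-* {M 0F 1F} {M 1F 0F} (M∈ℤ 0F 1F) (M∈ℤ 1F 0F))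

𝒮3⇒isInteger-det : ∀ (A : Mat 2) → 𝒮 A 3 → IsIntegerℚ (det A)
𝒮3⇒isInteger-det A A³∈ℤ =
  isInteger-cubicRoot {det A} {0ℚ} refl (subst IsIntegerℚ (det-^ᴹ3 A) (isInteger-det {A ^ᴹ 3} A³∈ℤ))

𝒮3⇒isInteger-tr : ∀ (A : Mat 2) → 𝒮 A 3 → IsIntegerℚ (tr A)
𝒮3⇒isInteger-tr A A³∈ℤ =
  isInteger-cubicRoot {tr A} { - (d + d + d)} -3d∈ℤ
    (subst IsIntegerℚ (tr-^ᴹ3 A) (isInteger-tr {A ^ᴹ 3} A³∈ℤ))
  where
  d = det A
  d∈ℤ : IsIntegerℚ d
  d∈ℤ = 𝒮3⇒isInteger-det A A³∈ℤ
  -3d∈ℤ : IsIntegerℚ (- (d + d + d))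
  -3d∈ℤ = isInteger-neg {d + d + d} (isInteger-+ {d + d} {d} (isInteger-+ {d} {d} d∈ℤ d∈ℤ) d∈ℤ)

𝒮-step : ∀ (A : Mat 2) → 𝒮 A 3 → ∀ {n} → 𝒮 A n → 𝒮 A (1 ℕ.+ n) → 𝒮 A (2 ℕ.+ n)
𝒮-step A A³∈ℤ {n} Aⁿ∈ℤ Aⁿ⁺¹∈ℤ i j = subst IsIntegerℚ (sym (cayleyHamilton-^ᴹ A n i j))
  (isInteger-- {tr A * (A ^ᴹ (1 ℕ.+ n)) i j} {det A * (A ^ᴹ n) i j}
    (isInteger-* {tr A} {(A ^ᴹ (1 ℕ.+ n)) i j} (𝒮3⇒isInteger-tr A A³∈ℤ) (Aⁿ⁺¹∈ℤ i j))
    (isInteger-* {det A} {(A ^ᴹ n) i j} (𝒮3⇒isInteger-det A A³∈ℤ) (Aⁿ∈ℤ i j)))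

𝒮-dim1 : ∀ (A : Mat 1) → 𝒮 A 3 → 𝒮 A 1
𝒮-dim1 A A³∈ℤ 0F 0F = subst IsIntegerℚ (sym (trans (ℚ.+-identityʳ (q * 1ℚ)) (ℚ.*-identityʳ q))) q∈ℤ
  where
  q = A 0F 0F
  cube : ∀ q → q * (q * (q * 1ℚ + 0ℚ) + 0ℚ) + 0ℚ ≡ q * q * q + 0ℚ * q
  cube = solve-∀ ℚ-ring
  q∈ℤ : IsIntegerℚ q
  q∈ℤ = isInteger-cubicRoot {q} {0ℚ} refl (subst IsIntegerℚ (cube q) (A³∈ℤ 0F 0F))

unrealizable-below-2 : ∀ {S} → S 3 → ¬ S 1 → ∀ d → d ℕ.< 2 → ¬ RealizableIn S d
unrealizable-below-2 3∈S 1∉S 0 _ (A , S⇔𝒮A) = 1∉S (Equivalence.from (S⇔𝒮A 1) λ ())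
unrealizable-below-2 3∈S 1∉S 1 _ (A , S⇔𝒮A) =
  1∉S (Equivalence.from (S⇔𝒮A 1) (𝒮-dim1 A (Equivalence.to (S⇔𝒮A 3) 3∈S)))
unrealizable-below-2 3∈S 1∉S (suc (suc d)) (ℕ.s≤s (ℕ.s≤s ()))

-- Residues modulo 3

rotate : Fin 3 → Fin 3
rotate 0F = 1F
rotate 1F = 2F
rotate 2F = 0F

-- Defined by iteration, so that residue (suc n) = rotate (residue n) holds by computation.
residue : ℕ → Fin 3
residue n = (rotate ^ᶠ n) 0F

residue-+ : ∀ d n → residue (d ℕ.+ n) ≡ (rotate ^ᶠ d) (residue n)
residue-+ d n = cong-app (^-homo rotate d n) 0F

toℕ-residue : ∀ n → toℕ (residue n) ≡ n % 3
toℕ-residue zero    = refl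
toℕ-residue (suc n) = begin
  toℕ (rotate (residue n))       ≡⟨ toℕ-rotate (residue n) ⟩
  (1 ℕ.+ toℕ (residue n)) % 3    ≡⟨ cong (λ r → (1 ℕ.+ r) % 3) (toℕ-residue n) ⟩
  (1 ℕ.+ n % 3) % 3              ≡⟨ DivMod.%-distribˡ-+ 1 n 3 ⟨
  suc n % 3                      ∎
  where
  open ≡-Reasoning
  toℕ-rotate : ∀ r → toℕ (rotate r) ≡ (1 ℕ.+ toℕ r) % 3
  toℕ-rotate 0F = refl
  toℕ-rotate 1F = refl
  toℕ-rotate 2F = refl

%3⇒residue : ∀ n {r} → n % 3 ≡ toℕ r → residue n ≡ r
%3⇒residue n n%3≡r = Fin.toℕ-injective (trans (toℕ-residue n) n%3≡r)

rotate^-orbit : ∀ n i → (rotate ^ᶠ n) i ≡ (rotate ^ᶠ toℕ i) (residue n)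
rotate^-orbit n 0F = refl
rotate^-orbit n 1F = ^ᶠ-comm rotate n 0F
rotate^-orbit n 2F = trans (^ᶠ-comm rotate n 1F) (cong rotate (^ᶠ-comm rotate n 0F))

residue-double : ∀ n → residue (n ℕ.+ n) ≡ (rotate ^ᶠ toℕ (residue n)) (residue n)
residue-double n = trans (residue-+ n n) (rotate^-orbit n (residue n))

rotate³ : ∀ r → rotate (rotate (rotate r)) ≡ r
rotate³ 0F = refl
rotate³ 1F = refl
rotate³ 2F = refl

rotate^-fixed⇒3∣ : ∀ d r → (rotate ^ᶠ d) r ≡ r → 3 Div.∣ d
rotate^-fixed⇒3∣ 0 r _ = 3 Div.∣0
rotate^-fixed⇒3∣ 1 0F ()
rotate^-fixed⇒3∣ 1 1F ()
rotate^-fixed⇒3∣ 1 2F ()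
rotate^-fixed⇒3∣ 2 0F ()
rotate^-fixed⇒3∣ 2 1F ()
rotate^-fixed⇒3∣ 2 2F ()
rotate^-fixed⇒3∣ (suc (suc (suc d))) r fixed =
  Div.∣m∣n⇒∣m+n (Div.∣-refl {3}) (rotate^-fixed⇒3∣ d r (trans (sym (rotate³ _)) fixed))

residue≡1⇒pred : ∀ n → residue n ≡ 1F → ∃ λ m → n ≡ suc m × residue m ≡ 0F
residue≡1⇒pred (suc m) r≡1 = m , refl , rotate≡1⇒ (residue m) r≡1
  where
  rotate≡1⇒ : ∀ r → rotate r ≡ 1F → r ≡ 0F
  rotate≡1⇒ 0F _ = refl
  rotate≡1⇒ 1F ()
  rotate≡1⇒ 2F ()

sameResidue⇒m≡q*3+n : ∀ {m n} → n ≤ m → residue m ≡ residue n → ∃ λ q → m ≡ q ℕ.* 3 ℕ.+ n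
sameResidue⇒m≡q*3+n {m} {n} n≤m m≡n with ℕ.m≤n⇒∃[o]m+o≡n n≤m
... | d , refl
  with rotate^-fixed⇒3∣ d (residue n) (trans (sym (residue-+ d n)) (trans (cong residue (ℕ.+-comm d n)) m≡n))
...   | divides q refl = q , ℕ.+-comm n (q ℕ.* 3)

sameResidue-≤+2⇒≤ : ∀ {m n} → residue m ≡ residue n → m ≤ n ℕ.+ 2 → m ≤ n
sameResidue-≤+2⇒≤ {m} {n} m≡n m≤n+2 with m ℕ.≤? n
... | yes m≤n = m≤n
... | no m≰n with sameResidue⇒m≡q*3+n (ℕ.<⇒≤ (ℕ.≰⇒> m≰n)) m≡n
...   | zero  , m≡0*3+n = contradiction (ℕ.≤-reflexive m≡0*3+n) m≰n
...   | suc q , refl    =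
  contradiction (ℕ.+-cancelˡ-≤ n 3 2 (ℕ.≤-trans n+3≤m m≤n+2)) λ { (ℕ.s≤s (ℕ.s≤s ())) }
  where
  n+3≤m : n ℕ.+ 3 ≤ 3 ℕ.+ (q ℕ.* 3 ℕ.+ n)
  n+3≤m = ℕ.≤-trans (ℕ.≤-reflexive (ℕ.+-comm n 3)) (ℕ.+-monoʳ-≤ 3 (ℕ.m≤n+m n (q ℕ.* 3)))

m≤m⊓n+∣m-n∣ : ∀ m n → m ≤ m ℕ.⊓ n ℕ.+ ∣ m - n ∣
m≤m⊓n+∣m-n∣ zero    n       = ℕ.z≤n
m≤m⊓n+∣m-n∣ (suc m) zero    = ℕ.≤-refl
m≤m⊓n+∣m-n∣ (suc m) (suc n) = ℕ.s≤s (m≤m⊓n+∣m-n∣ m n)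

m≤n+k∧n≤m+k⇒∣m-n∣≤k : ∀ {m n k} → m ≤ n ℕ.+ k → n ≤ m ℕ.+ k → ∣ m - n ∣ ≤ k
m≤n+k∧n≤m+k⇒∣m-n∣≤k {m} {n} m≤n+k n≤m+k with ℕ.∣m-n∣≡[m∸n]∨[n∸m] m n
... | inj₁ eq = subst (_≤ _) (sym eq) (ℕ.m≤n+o⇒m∸n≤o m n m≤n+k)
... | inj₂ eq = subst (_≤ _) (sym eq) (ℕ.m≤n+o⇒m∸n≤o n m n≤m+k)

-- Realizations

apery : ℕ → ℕ → Fin 3 → ℕ
apery a₁ a₂ 0F = 0
apery a₁ a₂ 1F = a₁
apery a₁ a₂ 2F = a₂

-- Going one (resp. two) steps along the cycle 0 → 1 → 2 → 0 raises the weight by at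
-- most a₁ (resp. a₂), with equality somewhere, provided a₂ ≤ 2 a₁ and a₁ ≤ 2 a₂.
cyclicWeights : ℕ → ℕ → Fin 3 → ℕ
cyclicWeights a₁ a₂ 0F = a₂
cyclicWeights a₁ a₂ 1F = a₁ ℕ.+ a₂
cyclicWeights a₁ a₂ 2F = a₁

module _ {a₁ a₂ : ℕ} (a₂≤2a₁ : a₂ ≤ a₁ ℕ.+ a₁) (a₁≤2a₂ : a₁ ≤ a₂ ℕ.+ a₂) (n : ℕ) where
  private
    w = cyclicWeights a₁ a₂

  cyclicMoves⇔ : ∀ r → (∀ i → w ((rotate ^ᶠ toℕ i) r) ≤ n ℕ.+ w i) ⇔ apery a₁ a₂ r ≤ n
  cyclicMoves⇔ 0F = mk⇔ (λ _ → ℕ.z≤n) (λ _ → moves)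
    where
    moves : ∀ i → w ((rotate ^ᶠ toℕ i) 0F) ≤ n ℕ.+ w i
    moves 0F = ℕ.m≤n+m a₂ n
    moves 1F = ℕ.m≤n+m (a₁ ℕ.+ a₂) n
    moves 2F = ℕ.m≤n+m a₁ n
  cyclicMoves⇔ 1F = mk⇔ (λ moves → ℕ.+-cancelʳ-≤ a₂ a₁ n (moves 0F)) moves
    where
    moves : a₁ ≤ n → ∀ i → w ((rotate ^ᶠ toℕ i) 1F) ≤ n ℕ.+ w i
    moves a₁≤n 0F = ℕ.+-monoˡ-≤ a₂ a₁≤n
    moves a₁≤n 1F = ℕ.≤-trans (ℕ.m≤m+n a₁ a₂) (ℕ.m≤n+m (a₁ ℕ.+ a₂) n)
    moves a₁≤n 2F = ℕ.≤-trans a₂≤2a₁ (ℕ.+-monoˡ-≤ a₁ a₁≤n)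
  cyclicMoves⇔ 2F =
    mk⇔ (λ moves → ℕ.+-cancelˡ-≤ a₁ a₂ n (ℕ.≤-trans (moves 2F) (ℕ.≤-reflexive (ℕ.+-comm n a₁)))) moves
    where
    moves : a₂ ≤ n → ∀ i → w ((rotate ^ᶠ toℕ i) 2F) ≤ n ℕ.+ w i
    moves a₂≤n 0F = ℕ.≤-trans a₁≤2a₂ (ℕ.+-monoˡ-≤ a₂ a₂≤n)
    moves a₂≤n 1F = ℕ.≤-trans (ℕ.m≤n+m a₂ a₁) (ℕ.m≤n+m (a₁ ℕ.+ a₂) n)
    moves a₂≤n 2F = ℕ.≤-trans (ℕ.+-monoʳ-≤ a₁ a₂≤n) (ℕ.≤-reflexive (ℕ.+-comm a₁ n))

  𝒮-cyclic : 𝒮 (weighted (permutation rotate) w) n ⇔ apery a₁ a₂ (residue n) ≤ n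
  𝒮-cyclic = ⇔.trans (weightedPermutation-𝒮 rotate w n) (⇔.trans orbits (cyclicMoves⇔ (residue n)))
    where
    orbits : (∀ i → w ((rotate ^ᶠ n) i) ≤ n ℕ.+ w i) ⇔
             (∀ i → w ((rotate ^ᶠ toℕ i) (residue n)) ≤ n ℕ.+ w i)
    orbits = mk⇔ (λ moves i → subst (λ k → w k ≤ n ℕ.+ w i) (rotate^-orbit n i) (moves i))
                 (λ moves i → subst (λ k → w k ≤ n ℕ.+ w i) (sym (rotate^-orbit n i)) (moves i))

-- companion is the companion matrix of x² + x + 1, so its powers repeat with period 3.
companion companion² : Mat 2
companion 0F 0F  = 0ℚ
companion 0F 1F  = - 1ℚ
companion 1F 0F  = 1ℚ
companion 1F 1F  = - 1ℚ
companion² 0F 0F = - 1ℚ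
companion² 0F 1F = 1ℚ
companion² 1F 0F = - 1ℚ
companion² 1F 1F = 0ℚ

companionPower : Fin 3 → Mat 2
companionPower 0F = identity
companionPower 1F = companion
companionPower 2F = companion²

companion-⊗ : ∀ r i j → (companion ⊗ companionPower r) i j ≡ companionPower (rotate r) i j
companion-⊗ 0F 0F 0F = refl
companion-⊗ 0F 0F 1F = refl
companion-⊗ 0F 1F 0F = refl
companion-⊗ 0F 1F 1F = refl
companion-⊗ 1F 0F 0F = refl
companion-⊗ 1F 0F 1F = refl
companion-⊗ 1F 1F 0F = refl
companion-⊗ 1F 1F 1F = refl
companion-⊗ 2F 0F 0F = refl
companion-⊗ 2F 0F 1F = refl
companion-⊗ 2F 1F 0F = refl
companion-⊗ 2F 1F 1F = refl

companion-^ᴹ : ∀ n i j → (companion ^ᴹ n) i j ≡ companionPower (residue n) i j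
companion-^ᴹ zero    i j = refl
companion-^ᴹ (suc n) i j =
  trans (sumFin-cong (λ k → cong (companion i k *_) (companion-^ᴹ n k j))) (companion-⊗ (residue n) i j)

companion∈ℤ : IntegralMat companion
companion∈ℤ 0F 0F = refl
companion∈ℤ 0F 1F = refl
companion∈ℤ 1F 0F = refl
companion∈ℤ 1F 1F = refl

companionWeights : ℕ → Fin 2 → ℕ
companionWeights k 0F = 0
companionWeights k 1F = k

𝒮-companion : ∀ k n → 𝒮 (weighted companion (companionWeights k)) n ⇔ (residue n ≡ 0F ⊎ k ≤ n)
𝒮-companion k n = mk⇔ to (weighted-𝒮 companion w n (integral⇒𝒮 companion∈ℤ n) ∘ support)
  where
  w = companionWeights k
  corner-unit : ∀ r → r ≢ 0F → companionPower r 0F 1F ≡ 1ℚ ⊎ companionPower r 0F 1F ≡ - 1ℚ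
  corner-unit 0F r≢0 = contradiction refl r≢0
  corner-unit 1F _   = inj₂ refl
  corner-unit 2F _   = inj₁ refl
  to : 𝒮 (weighted companion w) n → residue n ≡ 0F ⊎ k ≤ n
  to Aⁿ∈ℤ with residue n ≟ 0F
  ... | yes r≡0 = inj₁ r≡0
  ... | no r≢0  = inj₂ (subst (k ≤_) (ℕ.+-identityʳ n) (weighted-𝒮⁻¹ companion w n Aⁿ∈ℤ 0F 1F
                    (Sum.map (trans (companion-^ᴹ n 0F 1F)) (trans (companion-^ᴹ n 0F 1F))
                             (corner-unit (residue n) r≢0))))
  w≤k : ∀ j → w j ≤ k
  w≤k 0F = ℕ.z≤n
  w≤k 1F = ℕ.≤-refl
  support : residue n ≡ 0F ⊎ k ≤ n → ∀ i j → (companion ^ᴹ n) i j ≡ 0ℚ ⊎ w j ≤ n ℕ.+ w i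
  support (inj₁ r≡0) i j with i ≟ j
  ... | yes refl = inj₂ (ℕ.m≤n+m (w i) n)
  ... | no i≢j   = inj₁ (trans (companion-^ᴹ n i j)
                               (trans (cong (λ r → companionPower r i j) r≡0) (identity-≢ i≢j)))
  support (inj₂ k≤n) i j = inj₂ (ℕ.≤-trans (w≤k j) (ℕ.≤-trans k≤n (ℕ.m≤m+n n (w i))))

-- Apéry sets with respect to 3

module SemigroupContaining3 {S : SubsetN} (S-numerical : IsNumericalSemigroup S) (3∈S : S 3) where
  open IsNumericalSemigroup S-numerical

  *3∈ : ∀ q → S (q ℕ.* 3)
  *3∈ zero    = zero∈
  *3∈ (suc q) = +-closed 3∈S (*3∈ q)

  residue-0⇒∈ : ∀ {n} → residue n ≡ 0F → S n
  residue-0⇒∈ {n} r≡0 with rotate^-fixed⇒3∣ n 0F r≡0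
  ... | divides q refl = *3∈ q

  0-apery : InApery S 3 0
  0-apery = zero∈ , λ t t+3≡0 → contradiction (trans (ℕ.+-comm 3 t) t+3≡0) λ ()

  ∈-above : ∀ {a x} → S a → residue x ≡ residue a → a ≤ x → S x
  ∈-above a∈S x≡a a≤x with sameResidue⇒m≡q*3+n a≤x x≡a
  ... | q , refl = +-closed (*3∈ q) a∈S

  apery-≤ : ∀ {a x} → InApery S 3 a → S x → residue x ≡ residue a → a ≤ x
  apery-≤ {a} {x} (a∈S , a-3∉S) x∈S x≡a with a ℕ.≤? x
  ... | yes a≤x = a≤x
  ... | no a≰x with sameResidue⇒m≡q*3+n (ℕ.<⇒≤ (ℕ.≰⇒> a≰x)) (sym x≡a)
  ...   | zero  , a≡0*3+x   = contradiction (ℕ.≤-reflexive a≡0*3+x) a≰x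
  ...   | suc q , a≡3+q*3+x =
    contradiction (+-closed (*3∈ q) x∈S) (a-3∉S (q ℕ.* 3 ℕ.+ x) (trans (ℕ.+-comm _ 3) (sym a≡3+q*3+x)))

  module Apery {a₁ a₂ : ℕ} (a₁∈Ap : InApery S 3 a₁) (a₁≡1 : residue a₁ ≡ 1F)
                           (a₂∈Ap : InApery S 3 a₂) (a₂≡2 : residue a₂ ≡ 2F) where

    ∈⇔apery≤ : ∀ n → S n ⇔ apery a₁ a₂ (residue n) ≤ n
    ∈⇔apery≤ n = mk⇔
      (λ n∈S → apery-≤ (apery∈Ap (residue n)) n∈S (sym (residue-apery (residue n))))
      (∈-above (proj₁ (apery∈Ap (residue n))) (sym (residue-apery (residue n))))
      where
      apery∈Ap : ∀ r → InApery S 3 (apery a₁ a₂ r)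
      apery∈Ap 0F = 0-apery
      apery∈Ap 1F = a₁∈Ap
      apery∈Ap 2F = a₂∈Ap
      residue-apery : ∀ r → residue (apery a₁ a₂ r) ≡ r
      residue-apery 0F = refl
      residue-apery 1F = a₁≡1
      residue-apery 2F = a₂≡2

    a₂≤2a₁ : a₂ ≤ a₁ ℕ.+ a₁
    a₂≤2a₁ = apery-≤ a₂∈Ap (+-closed (proj₁ a₁∈Ap) (proj₁ a₁∈Ap))
      (trans (residue-double a₁) (trans (cong (λ r → (rotate ^ᶠ toℕ r) r) a₁≡1) (sym a₂≡2)))

    a₁≤2a₂ : a₁ ≤ a₂ ℕ.+ a₂
    a₁≤2a₂ = apery-≤ a₁∈Ap (+-closed (proj₁ a₂∈Ap) (proj₁ a₂∈Ap))
      (trans (residue-double a₂) (trans (cong (λ r → (rotate ^ᶠ toℕ r) r) a₂≡2) (sym a₁≡1)))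

    realizable₃ : RealizableIn S 3
    realizable₃ = weighted (permutation rotate) (cyclicWeights a₁ a₂) ,
                  λ n → ⇔.trans (∈⇔apery≤ n) (⇔.sym (𝒮-cyclic a₂≤2a₁ a₁≤2a₂ n))

    realizable₂⇒gap≤2 : RealizableIn S 2 → ∣ a₁ - a₂ ∣ ≤ 2
    realizable₂⇒gap≤2 (A , S⇔𝒮A) = m≤n+k∧n≤m+k⇒∣m-n∣≤k a₁≤a₂+2 a₂≤a₁+2
      where
      open Equivalence
      step : ∀ {n} → S n → S (1 ℕ.+ n) → S (2 ℕ.+ n)
      step {n} n∈S n+1∈S = from (S⇔𝒮A (2 ℕ.+ n))
        (𝒮-step A (to (S⇔𝒮A 3) 3∈S) {n} (to (S⇔𝒮A n) n∈S) (to (S⇔𝒮A (1 ℕ.+ n)) n+1∈S))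
      a₂≤a₁+2 : a₂ ≤ a₁ ℕ.+ 2
      a₂≤a₁+2 with residue≡1⇒pred a₁ a₁≡1
      ... | m , refl , m≡0 =
        ℕ.≤-trans a₂≤2+m (ℕ.≤-trans (ℕ.n≤1+n (2 ℕ.+ m)) (ℕ.≤-reflexive (cong suc (ℕ.+-comm 2 m))))
        where
        a₂≤2+m : a₂ ≤ 2 ℕ.+ m
        a₂≤2+m = apery-≤ a₂∈Ap (step (residue-0⇒∈ m≡0) (proj₁ a₁∈Ap))
                         (trans (cong rotate a₁≡1) (sym a₂≡2))
      a₁≤a₂+2 : a₁ ≤ a₂ ℕ.+ 2
      a₁≤a₂+2 = ℕ.≤-trans (apery-≤ a₁∈Ap (step (proj₁ a₂∈Ap) (residue-0⇒∈ (cong rotate a₂≡2)))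
                                    (trans (cong (rotate ∘ rotate) a₂≡2) (sym a₁≡1)))
                          (ℕ.≤-reflexive (ℕ.+-comm 2 a₂))

    gap≤2⇒realizable₂ : ∣ a₁ - a₂ ∣ ≤ 2 → RealizableIn S 2
    gap≤2⇒realizable₂ gap≤2 = weighted companion (companionWeights k) ,
      λ n → ⇔.trans (∈⇔apery≤ n) (⇔.trans (apery≤⇔ (residue n) refl) (⇔.sym (𝒮-companion k n)))
      where
      k = a₁ ℕ.⊓ a₂
      a₁≤k+2 : a₁ ≤ k ℕ.+ 2
      a₁≤k+2 = ℕ.≤-trans (m≤m⊓n+∣m-n∣ a₁ a₂) (ℕ.+-monoʳ-≤ k gap≤2)
      a₂≤k+2 : a₂ ≤ k ℕ.+ 2
      a₂≤k+2 = ℕ.≤-trans (m≤m⊓n+∣m-n∣ a₂ a₁)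
        (subst₂ (λ x y → x ℕ.+ y ≤ k ℕ.+ 2) (ℕ.⊓-comm a₁ a₂) (ℕ.∣-∣-comm a₁ a₂)
                (ℕ.+-monoʳ-≤ k gap≤2))
      above-k : ∀ {a n} → residue a ≡ residue n → a ≤ k ℕ.+ 2 → k ≤ n → a ≤ n
      above-k a≡n a≤k+2 k≤n = sameResidue-≤+2⇒≤ a≡n (ℕ.≤-trans a≤k+2 (ℕ.+-monoˡ-≤ 2 k≤n))
      apery≤⇔ : ∀ {n} r → residue n ≡ r → apery a₁ a₂ r ≤ n ⇔ (r ≡ 0F ⊎ k ≤ n)
      apery≤⇔ 0F _   = mk⇔ (λ _ → inj₁ refl) (λ _ → ℕ.z≤n)
      apery≤⇔ 1F n≡1 = mk⇔ (λ a₁≤n → inj₂ (ℕ.≤-trans (ℕ.m⊓n≤m a₁ a₂) a₁≤n)) from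
        where
        from : 1F ≡ 0F ⊎ k ≤ _ → a₁ ≤ _
        from (inj₂ k≤n) = above-k (trans a₁≡1 (sym n≡1)) a₁≤k+2 k≤n
      apery≤⇔ 2F n≡2 = mk⇔ (λ a₂≤n → inj₂ (ℕ.≤-trans (ℕ.m⊓n≤n a₁ a₂) a₂≤n)) from
        where
        from : 2F ≡ 0F ⊎ k ≤ _ → a₂ ≤ _
        from (inj₂ k≤n) = above-k (trans a₂≡2 (sym n≡2)) a₂≤k+2 k≤n

theorem3p4 : (S : SubsetN) → IsNumericalSemigroup S → HasMultiplicity S 3
    → (a₁ a₂ : ℕ) → InApery S 3 a₁ → a₁ % 3 ≡ 1 → InApery S 3 a₂ → a₂ % 3 ≡ 2
    → (∣ a₁ - a₂ ∣ ≤ 2 → MatDimIs S 2) × (∣ a₁ - a₂ ∣ > 2 → MatDimIs S 3)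
theorem3p4 S S-numerical (_ , 3∈S , small∉S) a₁ a₂ a₁∈Ap a₁%3≡1 a₂∈Ap a₂%3≡2 =
    (λ gap≤2 → gap≤2⇒realizable₂ gap≤2 , unrealizable-below-2 3∈S 1∉S)
  , (λ gap>2 → realizable₃ , unrealizable-below-3 gap>2)
  where
  open SemigroupContaining3 S-numerical 3∈S
  open Apery a₁∈Ap (%3⇒residue a₁ a₁%3≡1) a₂∈Ap (%3⇒residue a₂ a₂%3≡2)
  1∉S : ¬ S 1
  1∉S = small∉S 1 (ℕ.s≤s ℕ.z≤n) (ℕ.s≤s (ℕ.s≤s ℕ.z≤n))
  unrealizable-below-3 : ∣ a₁ - a₂ ∣ > 2 → ∀ d → d ℕ.< 3 → ¬ RealizableIn S d
  unrealizable-below-3 gap>2 d d<3 with ℕ.m<1+n⇒m<n∨m≡n d<3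
  ... | inj₁ d<2  = unrealizable-below-2 3∈S 1∉S d d<2
  ... | inj₂ refl = ℕ.<⇒≱ gap>2 ∘ realizable₂⇒gap≤2
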